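{- Let $\delta\in(0,1)$, let $\mathcal{C}:\{\pm1\}^k\to\{\pm1\}^n$ be a $(3,\delta)$-strong LDC with triple sets $M_1,\dots,M_k$, and let $H$ be its recovery hypergraph. Let $L$ be an augmentation of $H$. If $L$ is even, then for every $1\le i\le k$, $\lambda_L(i)$ is even.
   Context: A $(3,\delta)$-strong LDC is a map $\mathcal{C}:\{\pm1\}^k\to\{\pm1\}^n$ such that for every $i\in[k]$ there is a set $M_i$ of at least $\delta n$ pairwise disjoint $3$-element subsets of $[n]$ with $x_i=\mathcal{C}(x)_{j_1}\mathcal{C}(x)_{j_2}\mathcal{C}(x)_{j_3}$ for all $x\in\{\pm1\}^k$ and all $\{j_1,j_2,j_3\}\in M_i$; moreover for $i\ne i'$ a triple of $M_i$ and a triple of $M_{i'}$ share at most one element. The recovery hypergraph $H$ is the $3$-uniform hypergraph with vertex set $[n]$ and edge set $\bigcup_{i\in[k]}M_i$; a hyperedge in $M_i$ has color $i$. An augmentation $L$ of $H$ has vertex set $[n]$ and edge set a multiset of hyperedges each belonging to $E(H)$, with multiplicities $\mathsf{mult}_L(e)$. The degree of $v$ in $L$ is $\deg_L(v)=\sum_{e\in E(L),\,v\in e}\mathsf{mult}_L(e)$, and $L$ is even if $\deg_L(v)$ is even for every vertex $v$. For $1\le i\le k$, $\lambda_L(i)=\sum_{e\in E(L):\ e\text{ has color } i}\mathsf{mult}_L(e)$.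
   Formalization: The parameter δ of the strong LDC ranges over the rationals in (0,1). -}

module Defs where

open import Data.Nat using (ℕ; zero; suc; _≤_)
open import Data.Nat.Divisibility using (_∣_)
open import Data.Fin using (Fin; zero; suc)
open import Data.Fin.Subset using (Subset; _∩_; ∣_∣; _∈_; inside; outside)
open import Data.Fin.Subset.Properties using (_∈?_)
open import Data.Bool.Properties using () renaming (_≟_ to _≟𝔹_)
open import Data.Vec.Properties using (≡-dec)
open import Relation.Binary.Definitions using (DecidableEquality)
open import Data.Vec using (_∷_; [])
open import Data.List using (List; length; filter)
open import Data.List.Membership.Propositional using () renaming (_∈_ to _∈ₗ_)
open import Data.List.Relation.Unary.All using (All)
open import Data.List.Relation.Unary.AllPairs using (AllPairs)
open import Data.Sign using (Sign) renaming (_*_ to _·_)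
open import Data.Product using (∃; _×_)
open import Data.Integer using (+_)
open import Data.Rational using (ℚ; _/_) renaming (_*_ to _*ℚ_; _≤_ to _≤ℚ_)
open import Relation.Binary.PropositionalEquality using (_≡_; _≢_)

_≟ₛ_ : ∀ {n} → DecidableEquality (Subset n)
_≟ₛ_ = ≡-dec _≟𝔹_

module _ {n : ℕ} where
  open import Data.List.Membership.DecPropositional (_≟ₛ_ {n}) public using () renaming (_∈?_ to _∈ₗ?_)

-- A "vector of signs" {±1}^m, with ±1 represented by Data.Sign (+ ↦ 1, - ↦ -1,
-- multiplication of signs = multiplication of ±1).
Signs : ℕ → Set
Signs m = Fin m → Sign

prodOver : ∀ {n} → Signs n → Subset n → Sign
prodOver {zero}  y []              = Sign.+
prodOver {suc n} y (inside  ∷ s) = y zero · prodOver (λ j → y (suc j)) s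
prodOver {suc n} y (outside ∷ s) = prodOver (λ j → y (suc j)) s

Disjoint : ∀ {n} → Subset n → Subset n → Set
Disjoint s t = ∣ s ∩ t ∣ ≡ 0

ℕ→ℚ : ℕ → ℚ
ℕ→ℚ m = + m / 1

record IsStrongLDC (δ : ℚ) (k n : ℕ) (C : Signs k → Signs n)
                   (M : Fin k → List (Subset n)) : Set where
  field
    triples    : ∀ i → All (λ s → ∣ s ∣ ≡ 3) (M i)
    disjoint   : ∀ i → AllPairs Disjoint (M i)
    large      : ∀ i → δ *ℚ ℕ→ℚ n ≤ℚ ℕ→ℚ (length (M i))
    recovery   : ∀ i (x : Signs k) s → s ∈ₗ M i → x i ≡ prodOver (C x) s
    crossInter : ∀ i i' → i ≢ i' → ∀ s t → s ∈ₗ M i → t ∈ₗ M i' → ∣ s ∩ t ∣ ≤ 1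

-- hyperedges of the recovery hypergraph H: union of the M i
InH : ∀ {k n} → (Fin k → List (Subset n)) → Subset n → Set
InH {k} M e = ∃ λ (i : Fin k) → e ∈ₗ M i

-- An augmentation L of H: a finite multiset of hyperedges of H, represented
-- as a list (multiplicity of e = number of occurrences of e in the list).
IsAugmentation : ∀ {k n} → (Fin k → List (Subset n)) → List (Subset n) → Set
IsAugmentation M L = All (InH M) L

deg : ∀ {n} → List (Subset n) → Fin n → ℕ
deg L v = length (filter (v ∈?_) L)

Even : ℕ → Set
Even m = 2 ∣ m

IsEven : ∀ {n} → List (Subset n) → Set
IsEven {n} L = ∀ (v : Fin n) → Even (deg L v)

-- λ_L(i) = Σ_{e of colour i} mult_L(e); e has colour i iff e ∈ M i
lam : ∀ {k n} → (Fin k → List (Subset n)) → List (Subset n) → Fin k → ℕ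
lam M L i = length (filter (_∈ₗ? M i) L)

-- Fix a colour i and decode the message x that is -1 at coordinate i and +1
-- elsewhere, with codeword y = C x. Multiply ∏_{v ∈ e} y_v over all hyperedges e
-- of L. Grouped by vertex, this is ∏_v y_v ^ deg_L(v) = +1 because L is even.
-- Grouped by hyperedge, the recovery property turns the factor of each edge of
-- colour j into x_j, so the product is (-1) ^ λ_L(i).
module Submission where

open import Defs
open import Data.Nat using (ℕ; zero; suc; _*_)
open import Data.Nat.Divisibility using (divides)
open import Data.Fin using (Fin; zero; suc)
open import Data.Fin.Subset using (Subset; inside; outside)
open import Data.Fin.Subset.Properties using (_∈?_)
open import Data.List using (List; []; _∷_; map)
open import Data.List.Relation.Unary.All using ([]; _∷_)
open import Data.Vec using (_∷_; []; tail)
open import Data.Vec.Functional using (updateAt)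
open import Data.Vec.Functional.Properties using (updateAt-updates; updateAt-minimal)
open import Data.Sign using (Sign; opposite) renaming (_*_ to _·_)
open import Data.Sign.Properties
  using (s*s≡+; *-identityʳ; opposite-involutive; *-commutativeSemigroup)
open import Algebra.Properties.CommutativeSemigroup *-commutativeSemigroup
  using (interchange; x∙yz≈y∙xz)
open import Data.Bool using (true; false)
open import Data.Product using (_,_)
open import Data.Rational using (ℚ; 0ℚ; 1ℚ; _<_)
open import Function using (_∘_)
open import Relation.Nullary using (yes; no; does)
open import Relation.Binary.PropositionalEquality
  using (_≡_; _≢_; refl; sym; trans; cong; subst; module ≡-Reasoning)

open Sign

_^ˢ_ : Sign → ℕ → Sign
s ^ˢ zero  = +
s ^ˢ suc m = s · s ^ˢ m

^ˢ-double : ∀ s q → s ^ˢ (q * 2) ≡ +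
^ˢ-double s zero    = refl
^ˢ-double s (suc q) rewrite ^ˢ-double s q | *-identityʳ s = s*s≡+ s

^ˢ-even : ∀ s {m} → Even m → s ^ˢ m ≡ +
^ˢ-even s (divides q refl) = ^ˢ-double s q

-^ˢ≡+⇒even : ∀ m → - ^ˢ m ≡ + → Even m
-^ˢ≡+⇒even zero          _   = divides 0 refl
-^ˢ≡+⇒even (suc (suc m)) eq
  with -^ˢ≡+⇒even m (trans (sym (opposite-involutive (- ^ˢ m))) eq)
... | divides q refl = divides (suc q) refl

prodOverAll : ∀ {n} → Signs n → List (Subset n) → Sign
prodOverAll y []      = +
prodOverAll y (e ∷ L) = prodOver y e · prodOverAll y L

prodOverAll-peel : ∀ {n} (y : Signs (suc n)) (L : List (Subset (suc n))) →
  prodOverAll y L ≡ y zero ^ˢ deg L zero · prodOverAll (y ∘ suc) (map tail L)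
prodOverAll-peel y [] = refl
prodOverAll-peel y ((inside ∷ s) ∷ L) rewrite prodOverAll-peel y L =
  interchange (y zero) (prodOver (y ∘ suc) s)
              (y zero ^ˢ deg L zero) (prodOverAll (y ∘ suc) (map tail L))
prodOverAll-peel y ((outside ∷ s) ∷ L) rewrite prodOverAll-peel y L =
  x∙yz≈y∙xz (prodOver (y ∘ suc) s)
            (y zero ^ˢ deg L zero) (prodOverAll (y ∘ suc) (map tail L))

deg-map-tail : ∀ {n} (L : List (Subset (suc n))) v →
  deg L (suc v) ≡ deg (map tail L) v
deg-map-tail [] v = refl
deg-map-tail ((b ∷ s) ∷ L) v with does (v ∈? s)
... | true  = cong suc (deg-map-tail L v)
... | false = deg-map-tail L v

prodOverAll-even : ∀ {n} (y : Signs n) (L : List (Subset n)) →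
  IsEven L → prodOverAll y L ≡ +
prodOverAll-even {zero}  y []           _    = refl
prodOverAll-even {zero}  y ([] ∷ L)     _    = prodOverAll-even y L λ ()
prodOverAll-even {suc n} y L            even
  rewrite prodOverAll-peel y L | ^ˢ-even (y zero) (even zero) =
  prodOverAll-even (y ∘ suc) (map tail L)
    (λ v → subst Even (deg-map-tail L v) (even (suc v)))

module _ {δ : ℚ} {k n : ℕ} {C : Signs k → Signs n} {M : Fin k → List (Subset n)}
         (ldc : IsStrongLDC δ k n C M) where
  open IsStrongLDC ldc using (recovery)

  prodOverAll-decode : (x : Signs k) (i : Fin k) → (∀ j → j ≢ i → x j ≡ +) →
    ∀ L → IsAugmentation M L → prodOverAll (C x) L ≡ x i ^ˢ lam M L i
  prodOverAll-decode x i off-i [] [] = refl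
  prodOverAll-decode x i off-i (e ∷ L) ((j , e∈Mj) ∷ aug) with e ∈ₗ? M i
  ... | yes e∈Mi
    rewrite sym (recovery i x e e∈Mi) | prodOverAll-decode x i off-i L aug = refl
  ... | no e∉Mi
    rewrite sym (recovery j x e e∈Mj) | off-i j (λ { refl → e∉Mi e∈Mj })
          | prodOverAll-decode x i off-i L aug = refl

claim2p1 : (δ : ℚ) → 0ℚ < δ → δ < 1ℚ →
    (k n : ℕ) (C : Signs k → Signs n) (M : Fin k → List (Subset n)) →
    IsStrongLDC δ k n C M →
    (L : List (Subset n)) → IsAugmentation M L → IsEven L →
    ∀ (i : Fin k) → Even (lam M L i)
claim2p1 δ _ _ k n C M ldc L aug even i =
  -^ˢ≡+⇒even (lam M L i) (begin
    - ^ˢ lam M L i        ≡⟨ cong (_^ˢ lam M L i) (sym x-at-i) ⟩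
    x i ^ˢ lam M L i      ≡⟨ sym (prodOverAll-decode ldc x i x-off-i L aug) ⟩
    prodOverAll (C x) L   ≡⟨ prodOverAll-even (C x) L even ⟩
    +                     ∎)
  where
  open ≡-Reasoning
  x : Signs k
  x = updateAt (λ _ → +) i opposite
  x-at-i : x i ≡ -
  x-at-i = updateAt-updates i (λ _ → +)
  x-off-i : ∀ j → j ≢ i → x j ≡ +
  x-off-i j j≢i = updateAt-minimal j i (λ _ → +) j≢i
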